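{- Let $B$ be a Boolean algebra, $n\geq1$ an integer, and $h$ a function from the set $Div(n)$ of positive divisors of $n$ into the set of (lattice) filters of $B$. Let $$M(B,h)=\{f\in B^{[n]} : \xi_{d,q}(f)\in h(d)\text{ for every } d\in Div(n)\text{ and every integer }1\leq q\leq d\}.$$ Then $\langle M(B,h),\Rightarrow,\neg,\mathbb I\rangle$ is an $(n+1)$-valued Wajsberg subalgebra of $\langle B^{[n]},\Rightarrow,\neg,\mathbb I\rangle$. Moreover, if $h(d)=B$ for every $d\in Div(n)\setminus\{n\}$, then $M(B,h)$ is a Post algebra of order $n+1$.
   Context: $B^{[n]}$ is the set of functions $f:\{1,\ldots,n\}\to B$ with $f(i)\le f(j)$ whenever $i\le j$; $\mathbb I$ is the constant function $1$; for $f,g\in B^{[n]}$ and $1\le k\le n$, $(\neg f)(k)=\neg f(n+1-k)$ and $(f\Rightarrow g)(k)=\bigwedge_{i=1}^{n-k+1}(f(i)\to g(i+k-1))$, where $a\to b=\neg a\vee b$ in $B$. For $f\in B^{[n]}$, $d\in Div(n)$ and $1\le q\le d$, $\xi_{d,q}(f)=f(q\tfrac nd)\to f((q-1)\tfrac nd+1)$. A Wajsberg algebra is an algebra $\langle A,\to,\neg,1\rangle$ of type $(2,1,0)$ satisfying $1\to x=x$, $(x\to y)\to((y\to z)\to(x\to z))=1$, $(x\to y)\to y=(y\to x)\to x$, $(\neg y\to\neg x)\to(x\to y)=1$; an $(n+1)$-valued Wajsberg algebra is one in the variety generated by $L_{n+1}=\{0,\frac1n,\ldots,1\}$ with $x\to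 y=\min\{1,1-x+y\}$, $\neg x=1-x$. A Post algebra of order $n+1$ is meant in the sense of Boicescu–Filipoiu–Georgescu–Rudeanu; e.g. $B^{[n]}$ with pointwise lattice operations, constants $c_k$ ($0\le k\le n$) with $c_k(i)=1$ if $i\ge n+1-k$ and $0$ otherwise, negation $(\neg f)(i)=\neg f(n+1-i)$ and operators $\sigma_i(f)(j)=f(i)$, is a Post algebra of order $n+1$. -}

module Defs where

open import Level using (Level; _⊔_) renaming (suc to lsuc)
open import Data.Nat using (ℕ; zero; suc; _+_; _*_; _∸_; _≤_; _⊓_; _≤ᵇ_)
open import Data.Bool using (true; false)
open import Data.Fin using (Fin)
open import Data.Product using (_×_; Σ)
open import Relation.Binary.PropositionalEquality using (_≡_)
open import Relation.Binary.Structures using (IsEquivalence)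
open import Algebra.Lattice.Bundles using (BooleanAlgebra)

data Term (k : ℕ) : Set where
  var  : Fin k → Term k
  _⇒ₜ_ : Term k → Term k → Term k
  ¬ₜ_  : Term k → Term k
  𝟙ₜ   : Term k

-- The MV-chain L_{n+1} = {0, 1/n, ..., 1}, with i/n represented by i ≤ n:
-- x → y = min{1, 1 - x + y}  ↦  min{n, n - i + j};   ¬x = 1 - x  ↦  n - i.

module Chain (n : ℕ) where
  evalL : {k : ℕ} → (Fin k → ℕ) → Term k → ℕ
  evalL ρ (var v)  = ρ v
  evalL ρ (t ⇒ₜ s) = (n ∸ evalL ρ t + evalL ρ s) ⊓ n
  evalL ρ (¬ₜ t)   = n ∸ evalL ρ t
  evalL ρ 𝟙ₜ       = n

  ValidInL : {k : ℕ} → Term k → Term k → Set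
  ValidInL {k} t s = (ρ : Fin k → ℕ) → (∀ v → ρ v ≤ n) → evalL ρ t ≡ evalL ρ s

record Filter {c ℓ} (𝔹 : BooleanAlgebra c ℓ) (ℓ' : Level) : Set (c ⊔ ℓ ⊔ lsuc ℓ') where
  open BooleanAlgebra 𝔹
  field
    mem      : Carrier → Set ℓ'
    nonempty : Σ Carrier mem
    upward   : ∀ {x y} → mem x → (x ∧ y) ≈ x → mem y
    meet     : ∀ {x y} → mem x → mem y → mem (x ∧ y)

-- An element f ∈ B^[n] is represented by a
-- function f : ℕ → B of which only the values f 1, …, f n matter
-- (equality _≈ₙ_ compares exactly these values); InBn f says f is
-- monotone on {1,…,n}.

module Bn {a ℓ} (𝔹 : BooleanAlgebra a ℓ) (n : ℕ) where
  open BooleanAlgebra 𝔹 public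

  Fun : Set a
  Fun = ℕ → Carrier

  _≤B_ : Carrier → Carrier → Set ℓ
  x ≤B y = (x ∧ y) ≈ x

  _⇨_ : Carrier → Carrier → Carrier
  a ⇨ b = (¬ a) ∨ b

  bigMeet : (ℕ → Carrier) → ℕ → Carrier
  bigMeet a zero    = ⊤
  bigMeet a (suc m) = bigMeet a m ∧ a (suc m)

  _≈ₙ_ : Fun → Fun → Set ℓ
  f ≈ₙ g = ∀ k → 1 ≤ k → k ≤ n → f k ≈ g k

  InBn : Fun → Set ℓ
  InBn f = ∀ i j → 1 ≤ i → i ≤ j → j ≤ n → f i ≤B f j

  𝕀 : Fun
  𝕀 _ = ⊤

  ¬ₙ_ : Fun → Fun
  (¬ₙ f) k = ¬ (f (n + 1 ∸ k))

  _⇒ₙ_ : Fun → Fun → Fun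
  (f ⇒ₙ g) k = bigMeet (λ i → f i ⇨ g (i + k ∸ 1)) (n + 1 ∸ k)

  _∧ₙ_ : Fun → Fun → Fun
  (f ∧ₙ g) k = f k ∧ g k

  _∨ₙ_ : Fun → Fun → Fun
  (f ∨ₙ g) k = f k ∨ g k

  𝟘ₙ : Fun
  𝟘ₙ _ = ⊥

  𝟙ₙ : Fun
  𝟙ₙ _ = ⊤

  c : ℕ → Fun
  c k i with (n + 1 ∸ k) ≤ᵇ i
  ... | true  = ⊤
  ... | false = ⊥

  σ : ℕ → Fun → Fun
  σ i f _ = f i

  -- ξ_{d,q}(f) = f(q n/d) → f((q-1) n/d + 1), with e = n/d
  ξ : (e q : ℕ) → Fun → Carrier
  ξ e q f = f (q * e) ⇨ f ((q ∸ 1) * e + 1)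

  InM : ∀ {ℓ'} → (ℕ → Filter 𝔹 ℓ') → Fun → Set (ℓ ⊔ ℓ')
  InM h f = InBn f ×
            (∀ d e → d * e ≡ n → ∀ q → 1 ≤ q → q ≤ d → Filter.mem (h d) (ξ e q f))

  evalₙ : {k : ℕ} → (Fin k → Fun) → Term k → Fun
  evalₙ ρ (var v)  = ρ v
  evalₙ ρ (t ⇒ₜ s) = evalₙ ρ t ⇒ₙ evalₙ ρ s
  evalₙ ρ (¬ₜ t)   = ¬ₙ evalₙ ρ t
  evalₙ ρ 𝟙ₜ       = 𝕀

  -- A subset P of B^[n] is an (n+1)-valued Wajsberg subalgebra of
  -- ⟨B^[n], ⇒, ¬, 𝕀⟩: P ⊆ B^[n], P is closed under the operations, the
  -- Wajsberg axioms hold in P, and P lies in the variety generated by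
  -- L_{n+1}, i.e. (Birkhoff) every identity valid in L_{n+1} holds in P.
  record IsNValuedWajsbergSubalgebra {ℓP} (P : Fun → Set ℓP) : Set (a ⊔ ℓ ⊔ ℓP) where
    field
      sub      : ∀ {f} → P f → InBn f
      cong-¬   : ∀ {f g} → P f → P g → f ≈ₙ g → (¬ₙ f) ≈ₙ (¬ₙ g)
      cong-⇒   : ∀ {f f' g g'} → P f → P f' → P g → P g' → f ≈ₙ f' → g ≈ₙ g' →
                 (f ⇒ₙ g) ≈ₙ (f' ⇒ₙ g')
      closed-𝕀 : P 𝕀
      closed-¬ : ∀ {f} → P f → P (¬ₙ f)
      closed-⇒ : ∀ {f g} → P f → P g → P (f ⇒ₙ g)
      W1 : ∀ {x} → P x → (𝕀 ⇒ₙ x) ≈ₙ x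
      W2 : ∀ {x y z} → P x → P y → P z →
           ((x ⇒ₙ y) ⇒ₙ ((y ⇒ₙ z) ⇒ₙ (x ⇒ₙ z))) ≈ₙ 𝕀
      W3 : ∀ {x y} → P x → P y → ((x ⇒ₙ y) ⇒ₙ y) ≈ₙ ((y ⇒ₙ x) ⇒ₙ x)
      W4 : ∀ {x y} → P x → P y → (((¬ₙ y) ⇒ₙ (¬ₙ x)) ⇒ₙ (x ⇒ₙ y)) ≈ₙ 𝕀
      identities : ∀ {k} (t s : Term k) → Chain.ValidInL n t s →
                   (ρ : Fin k → Fun) → (∀ v → P (ρ v)) → evalₙ ρ t ≈ₙ evalₙ ρ s

  -- A subset P of B^[n], closed under the Post-algebra operations of
  -- B^[n] (pointwise ∧, ∨, 0, 1, negation ¬, operators σ_1..σ_n and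
  -- constants c_0..c_n), is a Post algebra of order n+1 in the sense of
  -- Boicescu–Filipoiu–Georgescu–Rudeanu: an (n+1)-valued
  -- Łukasiewicz–Moisil algebra (De Morgan algebra with σ_1,…,σ_n
  -- satisfying the LM axioms) with constants c_0,…,c_n such that
  -- σ_i(c_k) = 1 if i + k ≥ n+1 and 0 otherwise.
  record IsPostSubalgebra {ℓP} (P : Fun → Set ℓP) : Set (a ⊔ ℓ ⊔ ℓP) where
    field
      sub       : ∀ {f} → P f → InBn f
      cong-∧    : ∀ {f f' g g'} → P f → P f' → P g → P g' → f ≈ₙ f' → g ≈ₙ g' →
                  (f ∧ₙ g) ≈ₙ (f' ∧ₙ g')
      cong-∨    : ∀ {f f' g g'} → P f → P f' → P g → P g' → f ≈ₙ f' → g ≈ₙ g' →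
                  (f ∨ₙ g) ≈ₙ (f' ∨ₙ g')
      cong-¬    : ∀ {f g} → P f → P g → f ≈ₙ g → (¬ₙ f) ≈ₙ (¬ₙ g)
      cong-σ    : ∀ i → 1 ≤ i → i ≤ n → ∀ {f g} → P f → P g → f ≈ₙ g → σ i f ≈ₙ σ i g
      closed-∧  : ∀ {f g} → P f → P g → P (f ∧ₙ g)
      closed-∨  : ∀ {f g} → P f → P g → P (f ∨ₙ g)
      closed-¬  : ∀ {f} → P f → P (¬ₙ f)
      closed-0  : P 𝟘ₙ
      closed-1  : P 𝟙ₙ
      closed-σ  : ∀ i → 1 ≤ i → i ≤ n → ∀ {f} → P f → P (σ i f)
      closed-c  : ∀ k → k ≤ n → P (c k)
      ∧-comm    : ∀ {x y} → P x → P y → (x ∧ₙ y) ≈ₙ (y ∧ₙ x)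
      ∨-comm    : ∀ {x y} → P x → P y → (x ∨ₙ y) ≈ₙ (y ∨ₙ x)
      ∧-assoc   : ∀ {x y z} → P x → P y → P z → ((x ∧ₙ y) ∧ₙ z) ≈ₙ (x ∧ₙ (y ∧ₙ z))
      ∨-assoc   : ∀ {x y z} → P x → P y → P z → ((x ∨ₙ y) ∨ₙ z) ≈ₙ (x ∨ₙ (y ∨ₙ z))
      ∧-absorb  : ∀ {x y} → P x → P y → (x ∧ₙ (x ∨ₙ y)) ≈ₙ x
      ∨-absorb  : ∀ {x y} → P x → P y → (x ∨ₙ (x ∧ₙ y)) ≈ₙ x
      distrib   : ∀ {x y z} → P x → P y → P z →
                  (x ∧ₙ (y ∨ₙ z)) ≈ₙ ((x ∧ₙ y) ∨ₙ (x ∧ₙ z))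
      ∨-0       : ∀ {x} → P x → (x ∨ₙ 𝟘ₙ) ≈ₙ x
      ∧-1       : ∀ {x} → P x → (x ∧ₙ 𝟙ₙ) ≈ₙ x
      ¬-invol   : ∀ {x} → P x → (¬ₙ (¬ₙ x)) ≈ₙ x
      deMorgan  : ∀ {x y} → P x → P y → (¬ₙ (x ∧ₙ y)) ≈ₙ ((¬ₙ x) ∨ₙ (¬ₙ y))
      σ-∧       : ∀ i → 1 ≤ i → i ≤ n → ∀ {x y} → P x → P y →
                  σ i (x ∧ₙ y) ≈ₙ (σ i x ∧ₙ σ i y)
      σ-∨       : ∀ i → 1 ≤ i → i ≤ n → ∀ {x y} → P x → P y →
                  σ i (x ∨ₙ y) ≈ₙ (σ i x ∨ₙ σ i y)
      σ-0       : ∀ i → 1 ≤ i → i ≤ n → σ i 𝟘ₙ ≈ₙ 𝟘ₙ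
      σ-1       : ∀ i → 1 ≤ i → i ≤ n → σ i 𝟙ₙ ≈ₙ 𝟙ₙ
      σ-compl∨  : ∀ i → 1 ≤ i → i ≤ n → ∀ {x} → P x → (σ i x ∨ₙ (¬ₙ σ i x)) ≈ₙ 𝟙ₙ
      σ-compl∧  : ∀ i → 1 ≤ i → i ≤ n → ∀ {x} → P x → (σ i x ∧ₙ (¬ₙ σ i x)) ≈ₙ 𝟘ₙ
      σ-σ       : ∀ i j → 1 ≤ i → i ≤ n → 1 ≤ j → j ≤ n → ∀ {x} → P x →
                  σ i (σ j x) ≈ₙ σ j x
      σ-¬       : ∀ i → 1 ≤ i → i ≤ n → ∀ {x} → P x →
                  σ i (¬ₙ x) ≈ₙ (¬ₙ σ (n + 1 ∸ i) x)
      σ-mono    : ∀ i j → 1 ≤ i → i ≤ j → j ≤ n → ∀ {x} → P x →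
                  (σ i x ∧ₙ σ j x) ≈ₙ σ i x
      determine : ∀ {x y} → P x → P y →
                  (∀ i → 1 ≤ i → i ≤ n → σ i x ≈ₙ σ i y) → x ≈ₙ y
      σ-c-top   : ∀ i k → 1 ≤ i → i ≤ n → k ≤ n → n + 1 ≤ i + k → σ i (c k) ≈ₙ 𝟙ₙ
      σ-c-bot   : ∀ i k → 1 ≤ i → i ≤ n → k ≤ n → i + k ≤ n → σ i (c k) ≈ₙ 𝟘ₙ

-- Every operation of ⟨B^[n], ⇒, ¬, 𝕀⟩ is computed coordinatewise by Boolean
-- terms in the coordinates of its arguments, and the conditions defining
-- B^[n] and M(B,h) are Boolean inequalities between such terms.  A Boolean
-- entailment that holds in 2 under a hypothesis H holds in every Boolean
-- algebra wherever H evaluates to ⊤; taking for H the monotonicity of the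
-- arguments reduces everything to monotone functions {1,…,n} → 2.  Such a
-- function is determined by its threshold r (it is 1 exactly above r), and
-- in terms of thresholds ⇒, ¬, 𝕀 become y ∸ x, n ∸ x, 0: this is L_{n+1}
-- read through x ↦ n − x, so the identities of L_{n+1} hold in M(B,h).
-- The conditions ξ_{d,q} = 1 for 1 ≤ q ≤ d say that n/d divides the
-- threshold, which is preserved by ∸ and by n ∸ _; this gives closure.
-- If h(d) = B for d ≠ n, only ξ_{n,q}(f) = f(q) → f(q) = 1 remains, so
-- M(B,h) = B^[n], where the Post algebra laws hold pointwise.

module Submission where

open import Defs
open import Algebra.Bundles using (CommutativeMonoid; CommutativeSemiring)
open import Algebra.Lattice.Bundles using (BooleanAlgebra)
open import Data.Bool using (Bool; true; false; T; not)
  renaming (_∧_ to _∧ᵇ_; _∨_ to _∨ᵇ_)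
open import Data.Bool.Properties using (T-∧)
open import Data.Empty using (⊥-elim)
open import Data.Fin as Fin using (Fin; zero; suc)
open import Data.Nat as ℕ using (ℕ; zero; suc; _+_; _*_; _∸_; _⊓_; _⊔_; _≤_; _<_; z≤n; s≤s; _≤?_)
open import Data.Nat.Divisibility using (_∣_; divides)
open import Data.Nat.Properties
open import Data.Product using (_×_; _,_; proj₁; proj₂)
open import Data.Product.Properties using (≡-dec)
open import Data.Sum using (_⊎_; inj₁; inj₂)
open import Data.Unit using (tt)
open import Function using (case_of_)
open import Function.Bundles using (_⇔_; mk⇔; module Equivalence)
import Function.Properties.Equivalence as ⇔
open import Function.Related.TypeIsomorphisms using (→-cong-⇔; ¬-cong-⇔)
open import Relation.Binary.Definitions using (DecidableEquality)
open import Relation.Binary.PropositionalEquality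
  using (_≡_; refl; sym; trans; cong; cong₂; subst; subst₂; module ≡-Reasoning)
open import Relation.Nullary using (¬_; yes; no; contradiction)

open Equivalence using (to; from)

infixr 7 _∧ᵗ_
infixr 6 _∨ᵗ_
infixr 5 _⇨ᵗ_
infix  8 ¬ᵗ_

data BoolTerm (V : Set) : Set where
  atom      : V → BoolTerm V
  ⊤ᵗ        : BoolTerm V
  _∧ᵗ_ _∨ᵗ_ : BoolTerm V → BoolTerm V → BoolTerm V
  ¬ᵗ_       : BoolTerm V → BoolTerm V

_⇨ᵗ_ : ∀ {V} → BoolTerm V → BoolTerm V → BoolTerm V
s ⇨ᵗ t = ¬ᵗ s ∨ᵗ t

bigMeetᵗ : ∀ {V} → (ℕ → BoolTerm V) → ℕ → BoolTerm V
bigMeetᵗ F zero    = ⊤ᵗ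
bigMeetᵗ F (suc m) = bigMeetᵗ F m ∧ᵗ F (suc m)

finMeetᵗ : ∀ {V} k → (Fin k → BoolTerm V) → BoolTerm V
finMeetᵗ zero    F = ⊤ᵗ
finMeetᵗ (suc k) F = F zero ∧ᵗ finMeetᵗ k (λ v → F (suc v))

⟦_⟧₂ : ∀ {V} → BoolTerm V → (V → Bool) → Bool
⟦ atom x ⟧₂ β = β x
⟦ ⊤ᵗ ⟧₂     β = true
⟦ s ∧ᵗ t ⟧₂ β = ⟦ s ⟧₂ β ∧ᵇ ⟦ t ⟧₂ β
⟦ s ∨ᵗ t ⟧₂ β = ⟦ s ⟧₂ β ∨ᵇ ⟦ t ⟧₂ β
⟦ ¬ᵗ s ⟧₂   β = not (⟦ s ⟧₂ β)

T-⇨ : ∀ {a b} → T (not a ∨ᵇ b) ⇔ (T a → T b)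
T-⇨ {false} = mk⇔ (λ _ ()) (λ _ → tt)
T-⇨ {true}  = mk⇔ (λ Tb _ → Tb) (λ f → f tt)

T-not : ∀ {a} → T (not a) ⇔ (¬ T a)
T-not {false} = mk⇔ (λ _ ()) (λ _ → tt)
T-not {true}  = mk⇔ (λ ()) (λ f → f tt)

T-bigMeetᵗ : ∀ {V} (F : ℕ → BoolTerm V) β m →
             T (⟦ bigMeetᵗ F m ⟧₂ β) ⇔ (∀ i → 1 ≤ i → i ≤ m → T (⟦ F i ⟧₂ β))
T-bigMeetᵗ F β zero    = mk⇔ (λ _ i 1≤i i≤0 → contradiction (≤-trans 1≤i i≤0) λ ()) (λ _ → tt)
T-bigMeetᵗ F β (suc m) = mk⇔
  (λ T∧ i 1≤i i≤1+m → case m≤n⇒m<n∨m≡n i≤1+m of λ where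
     (inj₁ i<1+m) → to (T-bigMeetᵗ F β m) (proj₁ (to T-∧ T∧)) i 1≤i (≤-pred i<1+m)
     (inj₂ refl)  → proj₂ (to T-∧ T∧))
  (λ all → from T-∧ (from (T-bigMeetᵗ F β m) (λ i 1≤i i≤m → all i 1≤i (m≤n⇒m≤1+n i≤m)) ,
                     all (suc m) (s≤s z≤n) ≤-refl))

T-finMeetᵗ : ∀ {V} k (F : Fin k → BoolTerm V) β → T (⟦ finMeetᵗ k F ⟧₂ β) → ∀ v → T (⟦ F v ⟧₂ β)
T-finMeetᵗ (suc k) F β T∧ zero    = proj₁ (to T-∧ T∧)
T-finMeetᵗ (suc k) F β T∧ (suc v) = T-finMeetᵗ k (λ v → F (suc v)) β (proj₂ (to T-∧ T∧)) v

∀-bounded-cong : ∀ {P Q : ℕ → Set} {a b} → (∀ i → a ≤ i → i ≤ b → P i ⇔ Q i) →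
                 (∀ i → a ≤ i → i ≤ b → P i) ⇔ (∀ i → a ≤ i → i ≤ b → Q i)
∀-bounded-cong P⇔Q = mk⇔ (λ P i a≤i i≤b → to (P⇔Q i a≤i i≤b) (P i a≤i i≤b))
                         (λ Q i a≤i i≤b → from (P⇔Q i a≤i i≤b) (Q i a≤i i≤b))

-- Completeness of the two-element Boolean algebra

module BooleanCompleteness {c ℓ} (𝔹 : BooleanAlgebra c ℓ) where
  open import Data.List using (List; []; _∷_; _++_)
  open import Data.List.Membership.Propositional using (_∈_; _∉_)
  open import Data.List.Membership.Propositional.Properties using (∈-++⁺ˡ; ∈-++⁺ʳ)
  open import Data.List.Relation.Unary.Any using (here; there)
  open BooleanAlgebra 𝔹
    renaming (¬_ to ∁_; refl to ≈-refl; sym to ≈-sym; trans to ≈-trans)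
  open import Algebra.Lattice.Properties.BooleanAlgebra 𝔹
  open import Algebra.Properties.CommutativeSemigroup
    (CommutativeMonoid.commutativeSemigroup
      (CommutativeSemiring.+-commutativeMonoid ∧-∨-commutativeSemiring))
    using (interchange)
  open import Relation.Binary.Reasoning.Setoid setoid

  embed : Bool → Carrier
  embed true  = ⊤
  embed false = ⊥

  module _ {V : Set} where

    atoms : BoolTerm V → List V
    atoms (atom x) = x ∷ []
    atoms ⊤ᵗ       = []
    atoms (s ∧ᵗ t) = atoms s ++ atoms t
    atoms (s ∨ᵗ t) = atoms s ++ atoms t
    atoms (¬ᵗ s)   = atoms s

    ⟦_⟧ : BoolTerm V → (V → Carrier) → Carrier
    ⟦ atom x ⟧ ρ = ρ x
    ⟦ ⊤ᵗ ⟧     ρ = ⊤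
    ⟦ s ∧ᵗ t ⟧ ρ = ⟦ s ⟧ ρ ∧ ⟦ t ⟧ ρ
    ⟦ s ∨ᵗ t ⟧ ρ = ⟦ s ⟧ ρ ∨ ⟦ t ⟧ ρ
    ⟦ ¬ᵗ s ⟧   ρ = ∁ ⟦ s ⟧ ρ

    ⟦⟧-embed : ∀ s β → ⟦ s ⟧ (λ x → embed (β x)) ≈ embed (⟦ s ⟧₂ β)
    ⟦⟧-embed (atom x) β = ≈-refl
    ⟦⟧-embed ⊤ᵗ       β = ≈-refl
    ⟦⟧-embed (s ∧ᵗ t) β with ⟦ s ⟧₂ β | ⟦⟧-embed s β
    ... | true  | eq = ≈-trans (∧-cong eq (⟦⟧-embed t β)) (∧-identityˡ _)
    ... | false | eq = ≈-trans (∧-congʳ eq) (∧-zeroˡ _)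
    ⟦⟧-embed (s ∨ᵗ t) β with ⟦ s ⟧₂ β | ⟦⟧-embed s β
    ... | true  | eq = ≈-trans (∨-congʳ eq) (∨-zeroˡ _)
    ... | false | eq = ≈-trans (∨-cong eq (⟦⟧-embed t β)) (∨-identityˡ _)
    ⟦⟧-embed (¬ᵗ s)   β with ⟦ s ⟧₂ β | ⟦⟧-embed s β
    ... | true  | eq = ≈-trans (¬-cong eq) ¬⊤≈⊥
    ... | false | eq = ≈-trans (¬-cong eq) ¬⊥≈⊤

    -- Meeting with p is a Boolean homomorphism onto the interval [⊥, p].
    ⟦⟧-∧-relative : ∀ s {ρ ρ′} p → (∀ x → ρ x ∧ p ≈ ρ′ x ∧ p) →
                    ⟦ s ⟧ ρ ∧ p ≈ ⟦ s ⟧ ρ′ ∧ p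
    ⟦⟧-∧-relative (atom x) p eq = eq x
    ⟦⟧-∧-relative ⊤ᵗ       p eq = ≈-refl
    ⟦⟧-∧-relative (s ∧ᵗ t) {ρ} {ρ′} p eq = begin
      (⟦ s ⟧ ρ ∧ ⟦ t ⟧ ρ) ∧ p          ≈⟨ ∧-distribʳ-∧ _ _ p ⟩
      (⟦ s ⟧ ρ ∧ p) ∧ (⟦ t ⟧ ρ ∧ p)    ≈⟨ ∧-cong (⟦⟧-∧-relative s p eq) (⟦⟧-∧-relative t p eq) ⟩
      (⟦ s ⟧ ρ′ ∧ p) ∧ (⟦ t ⟧ ρ′ ∧ p)  ≈⟨ ∧-distribʳ-∧ _ _ p ⟨
      (⟦ s ⟧ ρ′ ∧ ⟦ t ⟧ ρ′) ∧ p        ∎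
      where
      ∧-distribʳ-∧ : ∀ a b q → (a ∧ b) ∧ q ≈ (a ∧ q) ∧ (b ∧ q)
      ∧-distribʳ-∧ a b q = ≈-trans (∧-congˡ (≈-sym (∧-idem q))) (interchange a b q q)
    ⟦⟧-∧-relative (s ∨ᵗ t) {ρ} {ρ′} p eq = begin
      (⟦ s ⟧ ρ ∨ ⟦ t ⟧ ρ) ∧ p          ≈⟨ ∧-distribʳ-∨ p _ _ ⟩
      (⟦ s ⟧ ρ ∧ p) ∨ (⟦ t ⟧ ρ ∧ p)    ≈⟨ ∨-cong (⟦⟧-∧-relative s p eq) (⟦⟧-∧-relative t p eq) ⟩
      (⟦ s ⟧ ρ′ ∧ p) ∨ (⟦ t ⟧ ρ′ ∧ p)  ≈⟨ ∧-distribʳ-∨ p _ _ ⟨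
      (⟦ s ⟧ ρ′ ∨ ⟦ t ⟧ ρ′) ∧ p        ∎
    ⟦⟧-∧-relative (¬ᵗ s) {ρ} {ρ′} p eq = begin
      ∁ ⟦ s ⟧ ρ ∧ p          ≈⟨ ∁[a∧p]∧p≈∁a∧p _ ⟨
      ∁ (⟦ s ⟧ ρ ∧ p) ∧ p    ≈⟨ ∧-congʳ (¬-cong (⟦⟧-∧-relative s p eq)) ⟩
      ∁ (⟦ s ⟧ ρ′ ∧ p) ∧ p   ≈⟨ ∁[a∧p]∧p≈∁a∧p _ ⟩
      ∁ ⟦ s ⟧ ρ′ ∧ p         ∎
      where
      ∁[a∧p]∧p≈∁a∧p : ∀ a → ∁ (a ∧ p) ∧ p ≈ ∁ a ∧ p
      ∁[a∧p]∧p≈∁a∧p a = begin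
        ∁ (a ∧ p) ∧ p            ≈⟨ ∧-congʳ (deMorgan₁ a p) ⟩
        (∁ a ∨ ∁ p) ∧ p          ≈⟨ ∧-distribʳ-∨ p (∁ a) (∁ p) ⟩
        (∁ a ∧ p) ∨ (∁ p ∧ p)    ≈⟨ ∨-congˡ (∧-complementˡ p) ⟩
        (∁ a ∧ p) ∨ ⊥            ≈⟨ ∨-identityʳ _ ⟩
        ∁ a ∧ p                  ∎

    ⟦⟧-cong-on-atoms : ∀ s {ρ ρ′} → (∀ x → x ∈ atoms s → ρ x ≈ ρ′ x) → ⟦ s ⟧ ρ ≈ ⟦ s ⟧ ρ′
    ⟦⟧-cong-on-atoms (atom x) eq = eq x (here refl)
    ⟦⟧-cong-on-atoms ⊤ᵗ       eq = ≈-refl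
    ⟦⟧-cong-on-atoms (s ∧ᵗ t) eq = ∧-cong
      (⟦⟧-cong-on-atoms s (λ x x∈ → eq x (∈-++⁺ˡ x∈)))
      (⟦⟧-cong-on-atoms t (λ x x∈ → eq x (∈-++⁺ʳ (atoms s) x∈)))
    ⟦⟧-cong-on-atoms (s ∨ᵗ t) eq = ∨-cong
      (⟦⟧-cong-on-atoms s (λ x x∈ → eq x (∈-++⁺ˡ x∈)))
      (⟦⟧-cong-on-atoms t (λ x x∈ → eq x (∈-++⁺ʳ (atoms s) x∈)))
    ⟦⟧-cong-on-atoms (¬ᵗ s)   eq = ¬-cong (⟦⟧-cong-on-atoms s eq)

  ≈-by-cases : ∀ {a b} p → a ∧ p ≈ b ∧ p → a ∧ ∁ p ≈ b ∧ ∁ p → a ≈ b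
  ≈-by-cases {a} {b} p eq₁ eq₂ = begin
    a                        ≈⟨ ∧-identityʳ a ⟨
    a ∧ ⊤                    ≈⟨ ∧-congˡ (∨-complementʳ p) ⟨
    a ∧ (p ∨ ∁ p)            ≈⟨ ∧-distribˡ-∨ a p (∁ p) ⟩
    (a ∧ p) ∨ (a ∧ ∁ p)      ≈⟨ ∨-cong eq₁ eq₂ ⟩
    (b ∧ p) ∨ (b ∧ ∁ p)      ≈⟨ ∧-distribˡ-∨ b p (∁ p) ⟨
    b ∧ (p ∨ ∁ p)            ≈⟨ ∧-congˡ (∨-complementʳ p) ⟩
    b ∧ ⊤                    ≈⟨ ∧-identityʳ b ⟩
    b                        ∎

  IsBit : Carrier → Set ℓ
  IsBit x = x ≈ ⊤ ⊎ x ≈ ⊥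

  bit : ∀ {x} → IsBit x → Bool
  bit (inj₁ _) = true
  bit (inj₂ _) = false

  ≈-embed-bit : ∀ {x} (b : IsBit x) → x ≈ embed (bit b)
  ≈-embed-bit (inj₁ x≈⊤) = x≈⊤
  ≈-embed-bit (inj₂ x≈⊥) = x≈⊥

  module _ {V : Set} (_≟_ : DecidableEquality V) where
    open import Data.List.Membership.DecPropositional _≟_ using (_∈?_)

    private
      _[_≔_] : (V → Carrier) → V → Carrier → V → Carrier
      (ρ [ x ≔ a ]) y with y ≟ x
      ... | yes _ = a
      ... | no  _ = ρ y

    -- Induction on the atoms where ρ may take values other than ⊤, ⊥: each
    -- one is split off by ≈-by-cases on its own value.
    valid⇒≈-outside : ∀ s t → (∀ β → ⟦ s ⟧₂ β ≡ ⟦ t ⟧₂ β) → ∀ L ρ →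
                      (∀ x → x ∉ L → IsBit (ρ x)) → ⟦ s ⟧ ρ ≈ ⟦ t ⟧ ρ
    valid⇒≈-outside s t valid [] ρ bits = begin
      ⟦ s ⟧ ρ                    ≈⟨ ⟦⟧-cong-on-atoms s (λ x _ → ρ≈ x) ⟩
      ⟦ s ⟧ (λ x → embed (β x))  ≈⟨ ⟦⟧-embed s β ⟩
      embed (⟦ s ⟧₂ β)           ≡⟨ cong embed (valid β) ⟩
      embed (⟦ t ⟧₂ β)           ≈⟨ ⟦⟧-embed t β ⟨
      ⟦ t ⟧ (λ x → embed (β x))  ≈⟨ ⟦⟧-cong-on-atoms t (λ x _ → ρ≈ x) ⟨
      ⟦ t ⟧ ρ                    ∎
      where
      β : V → Bool
      β x = bit (bits x λ ())
      ρ≈ : ∀ x → ρ x ≈ embed (β x)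
      ρ≈ x = ≈-embed-bit (bits x λ ())
    valid⇒≈-outside s t valid (x ∷ L) ρ bits = ≈-by-cases p
      (below ⊤ p (inj₁ ≈-refl) (≈-trans (∧-idem p) (≈-sym (∧-identityˡ p))))
      (below ⊥ (∁ p) (inj₂ ≈-refl) (≈-trans (∧-complementʳ p) (≈-sym (∧-zeroˡ (∁ p)))))
      where
      p = ρ x
      below : ∀ a q → IsBit a → p ∧ q ≈ a ∧ q → ⟦ s ⟧ ρ ∧ q ≈ ⟦ t ⟧ ρ ∧ q
      below a q a-bit p∧q≈a∧q = begin
        ⟦ s ⟧ ρ ∧ q   ≈⟨ ⟦⟧-∧-relative s q agree ⟩
        ⟦ s ⟧ ρ′ ∧ q  ≈⟨ ∧-congʳ (valid⇒≈-outside s t valid L ρ′ bits′) ⟩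
        ⟦ t ⟧ ρ′ ∧ q  ≈⟨ ⟦⟧-∧-relative t q agree ⟨
        ⟦ t ⟧ ρ ∧ q   ∎
        where
        ρ′ = ρ [ x ≔ a ]
        agree : ∀ y → ρ y ∧ q ≈ ρ′ y ∧ q
        agree y with y ≟ x
        ... | yes refl = p∧q≈a∧q
        ... | no  _      = ≈-refl
        bits′ : ∀ y → y ∉ L → IsBit (ρ′ y)
        bits′ y y∉L with y ≟ x
        ... | yes _   = a-bit
        ... | no  y≢x = bits y λ { (here y≡x) → y≢x y≡x ; (there y∈L) → y∉L y∈L }

    valid⇒≈ : ∀ s t → (∀ β → ⟦ s ⟧₂ β ≡ ⟦ t ⟧₂ β) → ∀ ρ → ⟦ s ⟧ ρ ≈ ⟦ t ⟧ ρ
    valid⇒≈ s t valid ρ = begin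
      ⟦ s ⟧ ρ   ≈⟨ ⟦⟧-cong-on-atoms s (λ x x∈ → ≈-sym (ρ′≈ρ x (∈-++⁺ˡ x∈))) ⟩
      ⟦ s ⟧ ρ′  ≈⟨ valid⇒≈-outside s t valid L ρ′ bits ⟩
      ⟦ t ⟧ ρ′  ≈⟨ ⟦⟧-cong-on-atoms t (λ x x∈ → ρ′≈ρ x (∈-++⁺ʳ (atoms s) x∈)) ⟩
      ⟦ t ⟧ ρ   ∎
      where
      L = atoms s ++ atoms t
      ρ′ : V → Carrier
      ρ′ x with x ∈? L
      ... | yes _ = ρ x
      ... | no  _ = ⊤
      ρ′≈ρ : ∀ x → x ∈ L → ρ′ x ≈ ρ x
      ρ′≈ρ x x∈L with x ∈? L
      ... | yes _   = ≈-refl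
      ... | no  x∉L = ⊥-elim (x∉L x∈L)
      bits : ∀ x → x ∉ L → IsBit (ρ′ x)
      bits x x∉L with x ∈? L
      ... | yes x∈L = ⊥-elim (x∉L x∈L)
      ... | no  _   = inj₁ ≈-refl

    valid⇒≤ : ∀ H s t → (∀ β → T (⟦ H ⟧₂ β) → T (⟦ s ⟧₂ β) → T (⟦ t ⟧₂ β)) →
              ∀ ρ → ⟦ H ⟧ ρ ≈ ⊤ → ⟦ s ⟧ ρ ∧ ⟦ t ⟧ ρ ≈ ⟦ s ⟧ ρ
    valid⇒≤ H s t valid ρ H≈⊤ = begin
      ⟦ s ⟧ ρ ∧ ⟦ t ⟧ ρ          ≈⟨ ∧-identityˡ _ ⟨
      ⊤ ∧ (⟦ s ⟧ ρ ∧ ⟦ t ⟧ ρ)    ≈⟨ ∧-congʳ H≈⊤ ⟨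
      ⟦ H ⟧ ρ ∧ (⟦ s ⟧ ρ ∧ ⟦ t ⟧ ρ)  ≈⟨ valid⇒≈ (H ∧ᵗ s ∧ᵗ t) (H ∧ᵗ s) (λ β → entails (valid β)) ρ ⟩
      ⟦ H ⟧ ρ ∧ ⟦ s ⟧ ρ          ≈⟨ ∧-congʳ H≈⊤ ⟩
      ⊤ ∧ ⟦ s ⟧ ρ                ≈⟨ ∧-identityˡ _ ⟩
      ⟦ s ⟧ ρ                    ∎
      where
      entails : ∀ {h a b} → (T h → T a → T b) → h ∧ᵇ (a ∧ᵇ b) ≡ h ∧ᵇ a
      entails {false}                 _ = refl
      entails {true}  {false}         _ = refl
      entails {true}  {true}  {true}  _ = refl
      entails {true}  {true}  {false} h = ⊥-elim (h tt tt)

-- Monotone Boolean sequences and their thresholds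

threshold : (ℕ → Bool) → ℕ → ℕ
threshold g zero    = zero
threshold g (suc m) with g (suc m)
... | true  = threshold g m
... | false = suc m

threshold≤ : ∀ g m → threshold g m ≤ m
threshold≤ g zero    = z≤n
threshold≤ g (suc m) with g (suc m)
... | true  = m≤n⇒m≤1+n (threshold≤ g m)
... | false = ≤-refl

MonotoneOn : (ℕ → Bool) → ℕ → Set
MonotoneOn g m = ∀ i j → 1 ≤ i → i ≤ j → j ≤ m → T (g i) → T (g j)

HasThresholdOn : (ℕ → Bool) → ℕ → ℕ → Set
HasThresholdOn g m x = ∀ i → 1 ≤ i → i ≤ m → T (g i) ⇔ x < i

threshold-correct : ∀ g m → MonotoneOn g m → HasThresholdOn g m (threshold g m)
threshold-correct g zero    mono i 1≤i i≤0 = contradiction (≤-trans 1≤i i≤0) λ ()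
threshold-correct g (suc m) mono i 1≤i i≤1+m with g (suc m) in g[1+m] | m≤n⇒m<n∨m≡n i≤1+m
... | true  | inj₁ i<1+m = threshold-correct g m mono′ i 1≤i (≤-pred i<1+m)
  where mono′ = λ i j 1≤i i≤j j≤m → mono i j 1≤i i≤j (m≤n⇒m≤1+n j≤m)
... | true  | inj₂ refl  = mk⇔ (λ _ → s≤s (threshold≤ g m)) (λ _ → subst T (sym g[1+m]) tt)
... | false | _          = mk⇔ (λ Tgi → ⊥-elim (subst T g[1+m] (mono i (suc m) 1≤i i≤1+m ≤-refl Tgi)))
                               (λ 1+m<i → contradiction i≤1+m (<⇒≱ 1+m<i))

n+1∸j≡1+n∸j : ∀ {n j} → j ≤ n → n + 1 ∸ j ≡ suc (n ∸ j)
n+1∸j≡1+n∸j {n} {j} j≤n = trans (+-∸-comm 1 j≤n) (+-comm (n ∸ j) 1)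

n+1∸j≤n : ∀ {n j} → 1 ≤ j → n + 1 ∸ j ≤ n
n+1∸j≤n {n} {j} 1≤j = subst (n + 1 ∸ j ≤_) (m+n∸n≡m n 1) (∸-monoʳ-≤ (n + 1) 1≤j)

1≤n+1∸j : ∀ {n j} → j ≤ n → 1 ≤ n + 1 ∸ j
1≤n+1∸j j≤n rewrite n+1∸j≡1+n∸j j≤n = s≤s z≤n

1≤i+j∸1 : ∀ {i j} → 1 ≤ i → 1 ≤ j → 1 ≤ i + j ∸ 1
1≤i+j∸1 {suc i} {j} _ 1≤j = ≤-trans 1≤j (m≤n+m j i)

i+j∸1≤n : ∀ {n i j} → j ≤ n → 1 ≤ i → i ≤ n + 1 ∸ j → i + j ∸ 1 ≤ n
i+j∸1≤n {n} {suc i} {j} j≤n _ i≤ rewrite n+1∸j≡1+n∸j j≤n =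
  subst (i + j ≤_) (m∸n+n≡m j≤n) (+-monoˡ-≤ j (≤-pred i≤))

≤∸-swap : ∀ {n a b} → a ≤ n → b ≤ n ∸ a → a ≤ n ∸ b
≤∸-swap {n} {a} {b} a≤n b≤n∸a =
  m+n≤o⇒m≤o∸n a (subst (_≤ n) (+-comm b a) (m≤o∸n⇒m+n≤o b a≤n b≤n∸a))

¬<n+1∸j⇔n∸a<j : ∀ {n a j} → a ≤ n → j ≤ n → (¬ a < n + 1 ∸ j) ⇔ n ∸ a < j
¬<n+1∸j⇔n∸a<j {n} {a} {j} a≤n j≤n rewrite n+1∸j≡1+n∸j j≤n = mk⇔
  (λ a≮ → ≰⇒> λ j≤n∸a → a≮ (s≤s (≤∸-swap a≤n j≤n∸a)))
  (λ n∸a<j a< → <⇒≱ n∸a<j (≤∸-swap j≤n (≤-pred a<)))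

∸<⇔<+ : ∀ {a b j} → 1 ≤ j → b ∸ a < j ⇔ b < a + j
∸<⇔<+ {a} {b} {suc j} _ = mk⇔
  (λ b∸a<j → ≤-<-trans (m≤n+m∸n b a) (+-monoʳ-< a b∸a<j))
  (m<n+o⇒m∸n<o b a)

shifted-<⇔<+ : ∀ {n a b j} → b ≤ n → j ≤ n →
               (∀ i → 1 ≤ i → i ≤ n + 1 ∸ j → a < i → b < i + j ∸ 1) ⇔ b < a + j
shifted-<⇔<+ {n} {a} {b} {j} b≤n j≤n = mk⇔ to′ from′
  where
  to′ : (∀ i → 1 ≤ i → i ≤ n + 1 ∸ j → a < i → b < i + j ∸ 1) → b < a + j
  to′ shifted with a + j ≤? n
  ... | yes a+j≤n = shifted (suc a) (s≤s z≤n)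
                      (subst (suc a ≤_) (sym (n+1∸j≡1+n∸j j≤n)) (s≤s (m+n≤o⇒m≤o∸n a a+j≤n)))
                      ≤-refl
  ... | no  a+j≰n = ≤-<-trans b≤n (≰⇒> a+j≰n)
  from′ : b < a + j → ∀ i → 1 ≤ i → i ≤ n + 1 ∸ j → a < i → b < i + j ∸ 1
  from′ b<a+j (suc i) _ _ (s≤s a≤i) = <-≤-trans b<a+j (+-monoˡ-≤ j a≤i)

[q∸1]*e+1≤q*e : ∀ {q e} → 1 ≤ q → 1 ≤ e → (q ∸ 1) * e + 1 ≤ q * e
[q∸1]*e+1≤q*e {suc q} {e} _ 1≤e = subst (_≤ e + q * e) (+-comm 1 (q * e)) (+-monoˡ-≤ (q * e) 1≤e)

-- x avoids the open block ((q ∸ 1) * e, q * e).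
AvoidsBlock : ℕ → ℕ → ℕ → Set
AvoidsBlock e q x = x < q * e → x < (q ∸ 1) * e + 1

∣⇒avoids-block : ∀ {e x} q → e ∣ x → AvoidsBlock e q x
∣⇒avoids-block {e} (suc q) (divides p refl) p*e<[1+q]*e =
  m≤n⇒m<n+1 (*-monoˡ-≤ e (≤-pred (*-cancelʳ-< e p (suc q) p*e<[1+q]*e)))
  where m≤n⇒m<n+1 : ∀ {m n} → m ≤ n → m < n + 1
        m≤n⇒m<n+1 {m} {n} m≤n = subst (m <_) (+-comm 1 n) (s≤s m≤n)

-- Descend through the blocks from the top one: x, lying below q * e, avoids
-- block q, hence lies below (q - 1) * e + 1, i.e. at most (q - 1) * e.
avoids-blocks⇒∣ : ∀ {d e x} → x ≤ d * e → (∀ q → 1 ≤ q → q ≤ d → AvoidsBlock e q x) → e ∣ x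
avoids-blocks⇒∣ {d} {e} {x} x≤d*e avoids with m≤n⇒m<n∨m≡n x≤d*e
... | inj₂ x≡d*e = divides d x≡d*e
... | inj₁ x<d*e = descend d ≤-refl x<d*e
  where
  descend : ∀ q → q ≤ d → x < q * e → e ∣ x
  descend zero    _ ()
  descend (suc q) 1+q≤d x<[1+q]*e
    with m≤n⇒m<n∨m≡n (≤-pred (subst (x <_) (+-comm (q * e) 1) (avoids (suc q) (s≤s z≤n) 1+q≤d x<[1+q]*e)))
  ... | inj₁ x<q*e = descend q (<⇒≤ 1+q≤d) x<q*e
  ... | inj₂ x≡q*e = divides q x≡q*e

∣m∣n⇒∣m∸n : ∀ {d m n} → d ∣ m → d ∣ n → d ∣ m ∸ n
∣m∣n⇒∣m∸n {d} (divides p refl) (divides q refl) = divides (p ∸ q) (sym (*-distribʳ-∸ d p q))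

∸-triangle : ∀ x y z → z ∸ x ≤ (z ∸ y) + (y ∸ x)
∸-triangle x y z = m≤n+o⇒m∸n≤o z x (begin
  z                        ≤⟨ m≤n+m∸n z y ⟩
  y + (z ∸ y)              ≤⟨ +-monoˡ-≤ (z ∸ y) (m≤n+m∸n y x) ⟩
  x + (y ∸ x) + (z ∸ y)    ≡⟨ +-assoc x _ _ ⟩
  x + ((y ∸ x) + (z ∸ y))  ≡⟨ cong (x +_) (+-comm (y ∸ x) _) ⟩
  x + ((z ∸ y) + (y ∸ x))  ∎)
  where open ≤-Reasoning

m∸[m∸n]≡n⊓m : ∀ m n → m ∸ (m ∸ n) ≡ n ⊓ m
m∸[m∸n]≡n⊓m m n = begin
  m ∸ (m ∸ n)                ≡⟨ cong (_∸ (m ∸ n)) (m⊓n+n∸m≡n n m) ⟨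
  (n ⊓ m + (m ∸ n)) ∸ (m ∸ n) ≡⟨ m+n∸n≡m (n ⊓ m) (m ∸ n) ⟩
  n ⊓ m                      ∎
  where open ≡-Reasoning

-- Under x ↦ n ∸ x, the chain L_{n+1} becomes {0,…,n} with x ⇒ y ↦ y ∸ x,
-- ¬ x ↦ n ∸ x and 1 ↦ 0; evalRank is term evaluation in this copy.
module Rank (n : ℕ) where
  open Chain n
  open ≡-Reasoning

  evalRank : ∀ {k} → (Fin k → ℕ) → Term k → ℕ
  evalRank r (var v)  = r v
  evalRank r (t ⇒ₜ s) = evalRank r s ∸ evalRank r t
  evalRank r (¬ₜ t)   = n ∸ evalRank r t
  evalRank r 𝟙ₜ       = 0

  evalRank-cong : ∀ {k} {r r′ : Fin k → ℕ} → (∀ v → r v ≡ r′ v) →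
                  ∀ t → evalRank r t ≡ evalRank r′ t
  evalRank-cong eq (var v)  = eq v
  evalRank-cong eq (t ⇒ₜ s) = cong₂ _∸_ (evalRank-cong eq s) (evalRank-cong eq t)
  evalRank-cong eq (¬ₜ t)   = cong (n ∸_) (evalRank-cong eq t)
  evalRank-cong eq 𝟙ₜ       = refl

  evalRank≤n : ∀ {k} {r : Fin k → ℕ} → (∀ v → r v ≤ n) → ∀ t → evalRank r t ≤ n
  evalRank≤n r≤n (var v)  = r≤n v
  evalRank≤n r≤n (t ⇒ₜ s) = ≤-trans (m∸n≤m (evalRank _ s) (evalRank _ t)) (evalRank≤n r≤n s)
  evalRank≤n r≤n (¬ₜ t)   = m∸n≤m n (evalRank _ t)
  evalRank≤n r≤n 𝟙ₜ       = z≤n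

  evalL≤n : ∀ {k} {α : Fin k → ℕ} → (∀ v → α v ≤ n) → ∀ t → evalL α t ≤ n
  evalL≤n α≤n (var v)  = α≤n v
  evalL≤n α≤n (t ⇒ₜ s) = m⊓n≤n _ n
  evalL≤n α≤n (¬ₜ t)   = m∸n≤m n (evalL _ t)
  evalL≤n α≤n 𝟙ₜ       = ≤-refl

  n∸[[n∸a+b]⊓n]≡[n∸b]∸[n∸a] : ∀ a b → n ∸ ((n ∸ a + b) ⊓ n) ≡ (n ∸ b) ∸ (n ∸ a)
  n∸[[n∸a+b]⊓n]≡[n∸b]∸[n∸a] a b = begin
    n ∸ ((n ∸ a + b) ⊓ n)        ≡⟨ ∸-distribˡ-⊓-⊔ n (n ∸ a + b) n ⟩
    (n ∸ (n ∸ a + b)) ⊔ (n ∸ n)  ≡⟨ cong (n ∸ (n ∸ a + b) ⊔_) (n∸n≡0 n) ⟩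
    (n ∸ (n ∸ a + b)) ⊔ 0        ≡⟨ ⊔-identityʳ _ ⟩
    n ∸ (n ∸ a + b)              ≡⟨ cong (n ∸_) (+-comm (n ∸ a) b) ⟩
    n ∸ (b + (n ∸ a))            ≡⟨ ∸-+-assoc n b (n ∸ a) ⟨
    (n ∸ b) ∸ (n ∸ a)            ∎

  n∸evalL≡evalRank : ∀ {k} (α : Fin k → ℕ) t → n ∸ evalL α t ≡ evalRank (λ v → n ∸ α v) t
  n∸evalL≡evalRank α (var v)  = refl
  n∸evalL≡evalRank α (t ⇒ₜ s) = begin
    n ∸ ((n ∸ evalL α t + evalL α s) ⊓ n)    ≡⟨ n∸[[n∸a+b]⊓n]≡[n∸b]∸[n∸a] (evalL α t) (evalL α s) ⟩
    (n ∸ evalL α s) ∸ (n ∸ evalL α t)        ≡⟨ cong₂ _∸_ (n∸evalL≡evalRank α s) (n∸evalL≡evalRank α t) ⟩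
    evalRank _ s ∸ evalRank _ t              ∎
  n∸evalL≡evalRank α (¬ₜ t)   = cong (n ∸_) (n∸evalL≡evalRank α t)
  n∸evalL≡evalRank α 𝟙ₜ       = n∸n≡0 n

  valid⇒evalRank≡ : ∀ {k} (t s : Term k) → ValidInL t s →
                    ∀ r → (∀ v → r v ≤ n) → evalRank r t ≡ evalRank r s
  valid⇒evalRank≡ t s valid r r≤n = begin
    evalRank r t               ≡⟨ evalRank-cong r≡ t ⟩
    evalRank (λ v → n ∸ α v) t ≡⟨ n∸evalL≡evalRank α t ⟨
    n ∸ evalL α t              ≡⟨ cong (n ∸_) (valid α (λ v → m∸n≤m n (r v))) ⟩
    n ∸ evalL α s              ≡⟨ n∸evalL≡evalRank α s ⟩
    evalRank (λ v → n ∸ α v) s ≡⟨ evalRank-cong r≡ s ⟨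
    evalRank r s               ∎
    where
    α = λ v → n ∸ r v
    r≡ : ∀ v → r v ≡ n ∸ α v
    r≡ v = sym (m∸[m∸n]≡n (r≤n v))

  evalRank≡⇒valid : ∀ {k} (t s : Term k) →
                    (∀ r → (∀ v → r v ≤ n) → evalRank r t ≡ evalRank r s) → ValidInL t s
  evalRank≡⇒valid t s same α α≤n =
    ∸-cancelˡ-≡ (evalL≤n α≤n t) (evalL≤n α≤n s) (begin
      n ∸ evalL α t              ≡⟨ n∸evalL≡evalRank α t ⟩
      evalRank (λ v → n ∸ α v) t ≡⟨ same _ (λ v → m∸n≤m n (α v)) ⟩
      evalRank (λ v → n ∸ α v) s ≡⟨ n∸evalL≡evalRank α s ⟨
      n ∸ evalL α s              ∎)

module WajsbergAxiomsInChain (n : ℕ) where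
  open Chain n
  open Rank n
  open ≡-Reasoning

  x₁ : Term 1
  x₁ = var zero

  x₂ y₂ : Term 2
  x₂ = var zero
  y₂ = var (suc zero)

  x₃ y₃ z₃ : Term 3
  x₃ = var zero
  y₃ = var (suc zero)
  z₃ = var (suc (suc zero))

  W1ₗ : Term 1
  W1ₗ = 𝟙ₜ ⇒ₜ x₁

  W2ₗ : Term 3
  W2ₗ = (x₃ ⇒ₜ y₃) ⇒ₜ ((y₃ ⇒ₜ z₃) ⇒ₜ (x₃ ⇒ₜ z₃))

  W3ₗ W3ᵣ W4ₗ : Term 2
  W3ₗ = (x₂ ⇒ₜ y₂) ⇒ₜ y₂
  W3ᵣ = (y₂ ⇒ₜ x₂) ⇒ₜ x₂
  W4ₗ = ((¬ₜ y₂) ⇒ₜ (¬ₜ x₂)) ⇒ₜ (x₂ ⇒ₜ y₂)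

  W1-valid : ValidInL W1ₗ x₁
  W1-valid = evalRank≡⇒valid W1ₗ x₁ λ _ _ → refl

  W2-valid : ValidInL W2ₗ 𝟙ₜ
  W2-valid = evalRank≡⇒valid W2ₗ 𝟙ₜ λ r _ →
    let x = r zero; y = r (suc zero); z = r (suc (suc zero)) in
    m≤n⇒m∸n≡0 (m≤n+o⇒m∸n≤o (z ∸ x) (z ∸ y) (∸-triangle x y z))

  W3-valid : ValidInL W3ₗ W3ᵣ
  W3-valid = evalRank≡⇒valid W3ₗ W3ᵣ λ r _ → let x = r zero; y = r (suc zero) in begin
    y ∸ (y ∸ x)  ≡⟨ m∸[m∸n]≡n⊓m y x ⟩
    x ⊓ y        ≡⟨ ⊓-comm x y ⟩
    y ⊓ x        ≡⟨ m∸[m∸n]≡n⊓m x y ⟨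
    x ∸ (x ∸ y)  ∎

  W4-valid : ValidInL W4ₗ 𝟙ₜ
  W4-valid = evalRank≡⇒valid W4ₗ 𝟙ₜ λ r r≤n → let x = r zero; y = r (suc zero) in begin
    (y ∸ x) ∸ ((n ∸ x) ∸ (n ∸ y))  ≡⟨ cong ((y ∸ x) ∸_) ([n∸x]∸[n∸y]≡y∸x x (r≤n (suc zero))) ⟩
    (y ∸ x) ∸ (y ∸ x)              ≡⟨ n∸n≡0 (y ∸ x) ⟩
    0                              ∎
    where
    [n∸x]∸[n∸y]≡y∸x : ∀ x {y} → y ≤ n → (n ∸ x) ∸ (n ∸ y) ≡ y ∸ x
    [n∸x]∸[n∸y]≡y∸x x {y} y≤n = begin
      (n ∸ x) ∸ (n ∸ y)  ≡⟨ ∸-+-assoc n x (n ∸ y) ⟩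
      n ∸ (x + (n ∸ y))  ≡⟨ cong (n ∸_) (+-comm x (n ∸ y)) ⟩
      n ∸ ((n ∸ y) + x)  ≡⟨ ∸-+-assoc n (n ∸ y) x ⟨
      (n ∸ (n ∸ y)) ∸ x  ≡⟨ cong (_∸ x) (m∸[m∸n]≡n y≤n) ⟩
      y ∸ x              ∎

-- Coordinates of term operations on B^[n]

module Translation (n : ℕ) where
  open Rank n

  Atom : ℕ → Set
  Atom k = Fin k × ℕ

  _≟ᵃ_ : ∀ {k} → DecidableEquality (Atom k)
  _≟ᵃ_ = ≡-dec Fin._≟_ ℕ._≟_

  -- component t j computes the j-th coordinate of t in B^[n], the atom
  -- (v , i) standing for the i-th coordinate of the v-th argument.
  component : ∀ {k} → Term k → ℕ → BoolTerm (Atom k)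
  component (var v)  j = atom (v , j)
  component (t ⇒ₜ s) j = bigMeetᵗ (λ i → component t i ⇨ᵗ component s (i + j ∸ 1)) (n + 1 ∸ j)
  component (¬ₜ t)   j = ¬ᵗ component t (n + 1 ∸ j)
  component 𝟙ₜ       j = ⊤ᵗ

  allMonotoneᵗ : ∀ k → BoolTerm (Atom k)
  allMonotoneᵗ k = finMeetᵗ k λ v →
    bigMeetᵗ (λ j → bigMeetᵗ (λ i → atom (v , i) ⇨ᵗ atom (v , j)) j) n

  ξᵗ : ∀ {V} → ℕ → ℕ → (ℕ → BoolTerm V) → BoolTerm V
  ξᵗ e q G = G (q * e) ⇨ᵗ G ((q ∸ 1) * e + 1)

  allξᵗ : ∀ k → ℕ → ℕ → BoolTerm (Atom k)
  allξᵗ k e d = finMeetᵗ k λ v → bigMeetᵗ (λ q → ξᵗ e q (λ i → atom (v , i))) d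

  Monotone : ∀ {k} → (Atom k → Bool) → Set
  Monotone β = ∀ v → MonotoneOn (λ i → β (v , i)) n

  T-allMonotoneᵗ : ∀ {k} β → T (⟦ allMonotoneᵗ k ⟧₂ β) → Monotone β
  T-allMonotoneᵗ {k} β T-mono v i j 1≤i i≤j j≤n = to T-⇨
    (to (T-bigMeetᵗ _ β j)
      (to (T-bigMeetᵗ _ β n) (T-finMeetᵗ k _ β T-mono v) j (≤-trans 1≤i i≤j) j≤n) i 1≤i i≤j)

  T-ξ⇔avoids-block : ∀ {d e q g x} → d * e ≡ n → 1 ≤ e → 1 ≤ q → q ≤ d → HasThresholdOn g n x →
                     T (not (g (q * e)) ∨ᵇ g ((q ∸ 1) * e + 1)) ⇔ AvoidsBlock e q x
  T-ξ⇔avoids-block {d} {e} {q} d*e≡n 1≤e 1≤q q≤d thr = ⇔.trans T-⇨ (→-cong-⇔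
    (thr (q * e) (*-mono-≤ 1≤q 1≤e) q*e≤n)
    (thr ((q ∸ 1) * e + 1) (m≤n+m 1 _) (≤-trans ([q∸1]*e+1≤q*e 1≤q 1≤e) q*e≤n)))
    where
    q*e≤n : q * e ≤ n
    q*e≤n = subst (q * e ≤_) d*e≡n (*-monoˡ-≤ e q≤d)

  module Thresholds {k} (β : Atom k → Bool) (mono : Monotone β) where
    r : Fin k → ℕ
    r v = threshold (λ i → β (v , i)) n

    r≤n : ∀ v → r v ≤ n
    r≤n v = threshold≤ _ n

    component-threshold : ∀ t → HasThresholdOn (λ j → ⟦ component t j ⟧₂ β) n (evalRank r t)
    component-threshold (var v) = threshold-correct _ n (mono v)
    component-threshold 𝟙ₜ j 1≤j j≤n = mk⇔ (λ _ → 1≤j) (λ _ → tt)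
    component-threshold (¬ₜ t) j 1≤j j≤n =
      ⇔.trans T-not (⇔.trans (¬-cong-⇔ (component-threshold t (n + 1 ∸ j) (1≤n+1∸j j≤n) (n+1∸j≤n 1≤j)))
                             (¬<n+1∸j⇔n∸a<j (evalRank≤n r≤n t) j≤n))
    component-threshold (t ⇒ₜ s) j 1≤j j≤n =
      ⇔.trans (T-bigMeetᵗ _ β (n + 1 ∸ j))
        (⇔.trans (∀-bounded-cong λ i 1≤i i≤ → ⇔.trans T-⇨ (→-cong-⇔
                    (component-threshold t i 1≤i (≤-trans i≤ (n+1∸j≤n 1≤j)))
                    (component-threshold s (i + j ∸ 1) (1≤i+j∸1 1≤i 1≤j) (i+j∸1≤n j≤n 1≤i i≤))))
          (⇔.trans (shifted-<⇔<+ (evalRank≤n r≤n s) j≤n) (⇔.sym (∸<⇔<+ 1≤j))))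

    module _ {d e} (d*e≡n : d * e ≡ n) (1≤e : 1 ≤ e) where

      T-allξᵗ⇒∣ : T (⟦ allξᵗ k e d ⟧₂ β) → ∀ v → e ∣ r v
      T-allξᵗ⇒∣ T-ξ v = avoids-blocks⇒∣ (subst (r v ≤_) (sym d*e≡n) (r≤n v)) λ q 1≤q q≤d →
        to (T-ξ⇔avoids-block d*e≡n 1≤e 1≤q q≤d (threshold-correct _ n (mono v)))
           (to (T-bigMeetᵗ _ β d) (T-finMeetᵗ k _ β T-ξ v) q 1≤q q≤d)

      ∣-evalRank : (∀ v → e ∣ r v) → ∀ t → e ∣ evalRank r t
      ∣-evalRank e∣r (var v)  = e∣r v
      ∣-evalRank e∣r (t ⇒ₜ s) = ∣m∣n⇒∣m∸n (∣-evalRank e∣r s) (∣-evalRank e∣r t)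
      ∣-evalRank e∣r (¬ₜ t)   = ∣m∣n⇒∣m∸n (divides d (sym d*e≡n)) (∣-evalRank e∣r t)
      ∣-evalRank e∣r 𝟙ₜ       = divides 0 refl

      T-ξᵗ-component : ∀ {q} → 1 ≤ q → q ≤ d → T (⟦ allξᵗ k e d ⟧₂ β) →
                       ∀ t → T (⟦ ξᵗ e q (component t) ⟧₂ β)
      T-ξᵗ-component {q} 1≤q q≤d T-ξ t =
        from (T-ξ⇔avoids-block d*e≡n 1≤e 1≤q q≤d (component-threshold t))
             (∣⇒avoids-block q (∣-evalRank (T-allξᵗ⇒∣ T-ξ) t))

module Closure {a ℓ ℓ′} (𝔹 : BooleanAlgebra a ℓ) (n : ℕ) (1≤n : 1 ≤ n) (h : ℕ → Filter 𝔹 ℓ′) where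
  open Bn 𝔹 n
    renaming (¬_ to ∁_; refl to ≈-refl; sym to ≈-sym; trans to ≈-trans)
  open import Algebra.Lattice.Properties.BooleanAlgebra 𝔹
  open BooleanCompleteness 𝔹 using (⟦_⟧; valid⇒≤)
  open Rank n
  open Translation n
  open WajsbergAxiomsInChain n
  open Filter using (mem; upward)
  open import Data.Vec.Functional using ([]; _∷_)
  open import Algebra.Properties.CommutativeSemigroup
    (CommutativeMonoid.commutativeSemigroup
      (CommutativeSemiring.+-commutativeMonoid ∧-∨-commutativeSemiring))
    using (interchange)
  open import Relation.Binary.Reasoning.Setoid setoid

  coordinates : ∀ {k} → (Fin k → Fun) → Atom k → Carrier
  coordinates ρ (v , i) = ρ v i

  ⟦bigMeetᵗ⟧ : ∀ {V} (F : ℕ → BoolTerm V) {G : ℕ → Carrier} ρ →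
               (∀ i → ⟦ F i ⟧ ρ ≡ G i) → ∀ m → ⟦ bigMeetᵗ F m ⟧ ρ ≡ bigMeet G m
  ⟦bigMeetᵗ⟧ F ρ F≡G zero    = refl
  ⟦bigMeetᵗ⟧ F ρ F≡G (suc m) = cong₂ _∧_ (⟦bigMeetᵗ⟧ F ρ F≡G m) (F≡G (suc m))

  ⟦component⟧ : ∀ {k} (t : Term k) ρ j → ⟦ component t j ⟧ (coordinates ρ) ≡ evalₙ ρ t j
  ⟦component⟧ (var v)  ρ j = refl
  ⟦component⟧ (t ⇒ₜ s) ρ j = ⟦bigMeetᵗ⟧ _ (coordinates ρ)
    (λ i → cong₂ _⇨_ (⟦component⟧ t ρ i) (⟦component⟧ s ρ (i + j ∸ 1))) (n + 1 ∸ j)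
  ⟦component⟧ (¬ₜ t)   ρ j = cong ∁_ (⟦component⟧ t ρ (n + 1 ∸ j))
  ⟦component⟧ 𝟙ₜ       ρ j = refl

  module _ {ℓf} (F : Filter 𝔹 ℓf) where

    mem-⊤ : mem F ⊤
    mem-⊤ = upward F (proj₂ (Filter.nonempty F)) (∧-identityʳ _)

    mem-bigMeetᵗ : ∀ {V} (G : ℕ → BoolTerm V) ρ m →
                   (∀ i → 1 ≤ i → i ≤ m → mem F (⟦ G i ⟧ ρ)) → mem F (⟦ bigMeetᵗ G m ⟧ ρ)
    mem-bigMeetᵗ G ρ zero    G∈F = mem-⊤
    mem-bigMeetᵗ G ρ (suc m) G∈F = Filter.meet F
      (mem-bigMeetᵗ G ρ m λ i 1≤i i≤m → G∈F i 1≤i (m≤n⇒m≤1+n i≤m))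
      (G∈F (suc m) (s≤s z≤n) ≤-refl)

    mem-finMeetᵗ : ∀ {V} k (G : Fin k → BoolTerm V) ρ →
                   (∀ v → mem F (⟦ G v ⟧ ρ)) → mem F (⟦ finMeetᵗ k G ⟧ ρ)
    mem-finMeetᵗ zero    G ρ G∈F = mem-⊤
    mem-finMeetᵗ (suc k) G ρ G∈F =
      Filter.meet F (G∈F zero) (mem-finMeetᵗ k (λ v → G (suc v)) ρ (λ v → G∈F (suc v)))

  -- With ⊤-filter, the mem-lemmas above also show that meets of ⊤'s are ⊤.
  ⊤-filter : Filter 𝔹 ℓ
  ⊤-filter = record
    { mem      = _≈ ⊤
    ; nonempty = ⊤ , ≈-refl
    ; upward   = λ {x} {y} x≈⊤ x∧y≈x → begin
        y      ≈⟨ ∧-identityˡ y ⟨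
        ⊤ ∧ y  ≈⟨ ∧-congʳ x≈⊤ ⟨
        x ∧ y  ≈⟨ x∧y≈x ⟩
        x      ≈⟨ x≈⊤ ⟩
        ⊤      ∎
    ; meet     = λ x≈⊤ y≈⊤ → ≈-trans (∧-cong x≈⊤ y≈⊤) (∧-idem ⊤)
    }

  ≤B⇒⇨≈⊤ : ∀ {x y} → x ≤B y → x ⇨ y ≈ ⊤
  ≤B⇒⇨≈⊤ {x} {y} x∧y≈x = begin
    ∁ x ∨ y              ≈⟨ ∨-congʳ (¬-cong x∧y≈x) ⟨
    ∁ (x ∧ y) ∨ y        ≈⟨ ∨-congʳ (deMorgan₁ x y) ⟩
    (∁ x ∨ ∁ y) ∨ y      ≈⟨ ∨-assoc (∁ x) (∁ y) y ⟩
    ∁ x ∨ (∁ y ∨ y)      ≈⟨ ∨-congˡ (∨-complementˡ y) ⟩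
    ∁ x ∨ ⊤              ≈⟨ ∨-zeroʳ (∁ x) ⟩
    ⊤                    ∎

  ⟦allMonotoneᵗ⟧≈⊤ : ∀ {k} (ρ : Fin k → Fun) → (∀ v → InBn (ρ v)) →
                     ⟦ allMonotoneᵗ k ⟧ (coordinates ρ) ≈ ⊤
  ⟦allMonotoneᵗ⟧≈⊤ {k} ρ mono = mem-finMeetᵗ ⊤-filter k _ (coordinates ρ) λ v →
    mem-bigMeetᵗ ⊤-filter _ (coordinates ρ) n λ j 1≤j j≤n →
      mem-bigMeetᵗ ⊤-filter _ (coordinates ρ) j λ i 1≤i i≤j →
        ≤B⇒⇨≈⊤ (mono v i j 1≤i i≤j j≤n)

  monotone-valid⇒≤B : ∀ {k} (s t : BoolTerm (Atom k)) →
    (∀ β → Monotone β → T (⟦ s ⟧₂ β) → T (⟦ t ⟧₂ β)) →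
    ∀ ρ → (∀ v → InBn (ρ v)) → ⟦ s ⟧ (coordinates ρ) ≤B ⟦ t ⟧ (coordinates ρ)
  monotone-valid⇒≤B {k} s t valid ρ mono =
    valid⇒≤ _≟ᵃ_ (allMonotoneᵗ k) s t (λ β T-mono → valid β (T-allMonotoneᵗ β T-mono))
      (coordinates ρ) (⟦allMonotoneᵗ⟧≈⊤ ρ mono)

  ≤B-antisym : ∀ {x y} → x ≤B y → y ≤B x → x ≈ y
  ≤B-antisym {x} {y} x∧y≈x y∧x≈y = ≈-trans (≈-sym x∧y≈x) (≈-trans (∧-comm x y) y∧x≈y)

  evalₙ-InBn : ∀ {k} (t : Term k) ρ → (∀ v → InBn (ρ v)) → InBn (evalₙ ρ t)
  evalₙ-InBn t ρ mono i j 1≤i i≤j j≤n =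
    subst₂ _≤B_ (⟦component⟧ t ρ i) (⟦component⟧ t ρ j)
      (monotone-valid⇒≤B (component t i) (component t j) valid ρ mono)
    where
    valid : ∀ β → Monotone β →
            T (⟦ component t i ⟧₂ β) → T (⟦ component t j ⟧₂ β)
    valid β mono₂ T-i = from (component-threshold t j (≤-trans 1≤i i≤j) j≤n)
      (<-≤-trans (to (component-threshold t i 1≤i (≤-trans i≤j j≤n)) T-i) i≤j)
      where open Thresholds β mono₂

  d*e≡n⇒1≤e : ∀ {d e} → d * e ≡ n → 1 ≤ e
  d*e≡n⇒1≤e {d} {zero}  d*0≡n = ⊥-elim (<⇒≢ 1≤n (trans (sym (*-zeroʳ d)) d*0≡n))
  d*e≡n⇒1≤e {d} {suc e} _     = s≤s z≤n

  evalₙ-ξ : ∀ {k} (t : Term k) ρ → (∀ v → InM h (ρ v)) →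
            ∀ d e → d * e ≡ n → ∀ q → 1 ≤ q → q ≤ d → mem (h d) (ξ e q (evalₙ ρ t))
  evalₙ-ξ {k} t ρ ρ∈M d e d*e≡n q 1≤q q≤d =
    subst (mem (h d)) (cong₂ _⇨_ (⟦component⟧ t ρ (q * e)) (⟦component⟧ t ρ ((q ∸ 1) * e + 1)))
      (upward (h d) allξ∈h[d]
        (monotone-valid⇒≤B (allξᵗ k e d) (ξᵗ e q (component t)) valid ρ (λ v → proj₁ (ρ∈M v))))
    where
    allξ∈h[d] : mem (h d) (⟦ allξᵗ k e d ⟧ (coordinates ρ))
    allξ∈h[d] = mem-finMeetᵗ (h d) k _ (coordinates ρ) λ v →
      mem-bigMeetᵗ (h d) _ (coordinates ρ) d (proj₂ (ρ∈M v) d e d*e≡n)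
    valid : ∀ β → Monotone β →
            T (⟦ allξᵗ k e d ⟧₂ β) → T (⟦ ξᵗ e q (component t) ⟧₂ β)
    valid β mono₂ T-ξ = T-ξᵗ-component d*e≡n (d*e≡n⇒1≤e {d} d*e≡n) 1≤q q≤d T-ξ t
      where open Thresholds β mono₂

  evalₙ-InM : ∀ {k} (t : Term k) ρ → (∀ v → InM h (ρ v)) → InM h (evalₙ ρ t)
  evalₙ-InM t ρ ρ∈M = evalₙ-InBn t ρ (λ v → proj₁ (ρ∈M v)) , evalₙ-ξ t ρ ρ∈M

  identities-hold : ∀ {k} (t s : Term k) → Chain.ValidInL n t s →
                    ∀ ρ → (∀ v → InM h (ρ v)) → evalₙ ρ t ≈ₙ evalₙ ρ s
  identities-hold t s valid ρ ρ∈M j 1≤j j≤n =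
    subst₂ _≈_ (⟦component⟧ t ρ j) (⟦component⟧ s ρ j) (≤B-antisym
      (monotone-valid⇒≤B (component t j) (component s j) (transfer t s valid) ρ mono)
      (monotone-valid⇒≤B (component s j) (component t j) (transfer s t (λ α α≤n → sym (valid α α≤n))) ρ mono))
    where
    mono = λ v → proj₁ (ρ∈M v)
    transfer : ∀ t s → Chain.ValidInL n t s → ∀ β → Monotone β →
               T (⟦ component t j ⟧₂ β) → T (⟦ component s j ⟧₂ β)
    transfer t s valid β mono₂ T-t = from (component-threshold s j 1≤j j≤n)
      (subst (_< j) (valid⇒evalRank≡ t s valid r r≤n) (to (component-threshold t j 1≤j j≤n) T-t))
      where open Thresholds β mono₂

  bigMeet-cong : ∀ {G G′ : ℕ → Carrier} m → (∀ i → 1 ≤ i → i ≤ m → G i ≈ G′ i) →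
                 bigMeet G m ≈ bigMeet G′ m
  bigMeet-cong zero    G≈G′ = ≈-refl
  bigMeet-cong (suc m) G≈G′ = ∧-cong
    (bigMeet-cong m λ i 1≤i i≤m → G≈G′ i 1≤i (m≤n⇒m≤1+n i≤m))
    (G≈G′ (suc m) (s≤s z≤n) ≤-refl)

  ¬ₙ-cong : ∀ {f g} → f ≈ₙ g → (¬ₙ f) ≈ₙ (¬ₙ g)
  ¬ₙ-cong f≈g j 1≤j j≤n = ¬-cong (f≈g (n + 1 ∸ j) (1≤n+1∸j j≤n) (n+1∸j≤n 1≤j))

  ⇒ₙ-cong : ∀ {f f′ g g′} → f ≈ₙ f′ → g ≈ₙ g′ → (f ⇒ₙ g) ≈ₙ (f′ ⇒ₙ g′)
  ⇒ₙ-cong f≈f′ g≈g′ j 1≤j j≤n = bigMeet-cong (n + 1 ∸ j) λ i 1≤i i≤n+1∸j → ∨-cong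
    (¬-cong (f≈f′ i 1≤i (≤-trans i≤n+1∸j (n+1∸j≤n 1≤j))))
    (g≈g′ (i + j ∸ 1) (1≤i+j∸1 1≤i 1≤j) (i+j∸1≤n j≤n 1≤i i≤n+1∸j))

  wajsberg : IsNValuedWajsbergSubalgebra (InM h)
  wajsberg = record
    { sub        = proj₁
    ; cong-¬     = λ _ _ → ¬ₙ-cong
    ; cong-⇒     = λ _ _ _ _ → ⇒ₙ-cong
    ; closed-𝕀   = evalₙ-InM 𝟙ₜ [] λ ()
    ; closed-¬   = λ {f} f∈M → evalₙ-InM (¬ₜ x₁) (f ∷ []) λ { zero → f∈M }
    ; closed-⇒   = λ {f} {g} f∈M g∈M →
        evalₙ-InM (x₂ ⇒ₜ y₂) (f ∷ g ∷ []) λ { zero → f∈M ; (suc zero) → g∈M }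
    ; W1         = λ {x} x∈M → identities-hold W1ₗ x₁ W1-valid (x ∷ []) λ { zero → x∈M }
    ; W2         = λ {x} {y} {z} x∈M y∈M z∈M → identities-hold W2ₗ 𝟙ₜ W2-valid (x ∷ y ∷ z ∷ [])
        λ { zero → x∈M ; (suc zero) → y∈M ; (suc (suc zero)) → z∈M }
    ; W3         = λ {x} {y} x∈M y∈M → identities-hold W3ₗ W3ᵣ W3-valid (x ∷ y ∷ [])
        λ { zero → x∈M ; (suc zero) → y∈M }
    ; W4         = λ {x} {y} x∈M y∈M → identities-hold W4ₗ 𝟙ₜ W4-valid (x ∷ y ∷ [])
        λ { zero → x∈M ; (suc zero) → y∈M }
    ; identities = identities-hold
    }

  ∧-mono-≤B : ∀ {x x′ y y′} → x ≤B x′ → y ≤B y′ → (x ∧ y) ≤B (x′ ∧ y′)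
  ∧-mono-≤B {x} {x′} {y} {y′} x≤x′ y≤y′ = ≈-trans (interchange x y x′ y′) (∧-cong x≤x′ y≤y′)

  ≤B-∨ʳ : ∀ {x y} z → x ≤B y → x ≤B (y ∨ z)
  ≤B-∨ʳ {x} {y} z x∧y≈x = begin
    x ∧ (y ∨ z)          ≈⟨ ∧-distribˡ-∨ x y z ⟩
    (x ∧ y) ∨ (x ∧ z)    ≈⟨ ∨-congʳ x∧y≈x ⟩
    x ∨ (x ∧ z)          ≈⟨ ∨-absorbs-∧ x z ⟩
    x                    ∎

  ∨-mono-≤B : ∀ {x x′ y y′} → x ≤B x′ → y ≤B y′ → (x ∨ y) ≤B (x′ ∨ y′)
  ∨-mono-≤B {x} {x′} {y} {y′} x≤x′ y≤y′ = begin
    (x ∨ y) ∧ (x′ ∨ y′)                  ≈⟨ ∧-distribʳ-∨ (x′ ∨ y′) x y ⟩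
    (x ∧ (x′ ∨ y′)) ∨ (y ∧ (x′ ∨ y′))    ≈⟨ ∨-cong (≤B-∨ʳ y′ x≤x′) (∧-congˡ (∨-comm x′ y′)) ⟩
    x ∨ (y ∧ (y′ ∨ x′))                  ≈⟨ ∨-congˡ (≤B-∨ʳ x′ y≤y′) ⟩
    x ∨ y                                ∎

  c≈⊤ : ∀ k {i} → n + 1 ∸ k ≤ i → c k i ≈ ⊤
  c≈⊤ k {i} n+1∸k≤i with n + 1 ∸ k ℕ.≤ᵇ i in ≤ᵇ≡
  ... | true  = ≈-refl
  ... | false = ⊥-elim (subst T ≤ᵇ≡ (≤⇒≤ᵇ n+1∸k≤i))

  c≈⊥ : ∀ k {i} → i < n + 1 ∸ k → c k i ≈ ⊥
  c≈⊥ k {i} i<n+1∸k with n + 1 ∸ k ℕ.≤ᵇ i in ≤ᵇ≡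
  ... | true  = contradiction (≤ᵇ⇒≤ _ _ (subst T (sym ≤ᵇ≡) tt)) (<⇒≱ i<n+1∸k)
  ... | false = ≈-refl

  c-InBn : ∀ k → InBn (c k)
  c-InBn k i j _ i≤j _ with n + 1 ∸ k ≤? i
  ... | yes ≤i = ≈-trans (∧-cong (c≈⊤ k ≤i) (c≈⊤ k (≤-trans ≤i i≤j))) (≈-trans (∧-idem ⊤) (≈-sym (c≈⊤ k ≤i)))
  ... | no  ≰i = ≈-trans (∧-congʳ (c≈⊥ k (≰⇒> ≰i))) (≈-trans (∧-zeroˡ _) (≈-sym (c≈⊥ k (≰⇒> ≰i))))

  module Post (B-below-n : ∀ d → d ∣ n → ¬ d ≡ n → ∀ x → mem (h d) x) where

    -- The only constraint left is for d = n, where ξ_{n,q}(f) = f(q) → f(q) = ⊤.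
    InBn⇒InM : ∀ {f} → InBn f → InM h f
    InBn⇒InM {f} mono = mono , ξ∈h
      where
      ξ∈h : ∀ d e → d * e ≡ n → ∀ q → 1 ≤ q → q ≤ d → mem (h d) (ξ e q f)
      ξ∈h d e d*e≡n q 1≤q q≤d with d ℕ.≟ n
      ... | no  d≢n = B-below-n d (divides e (trans (sym d*e≡n) (*-comm d e))) d≢n _
      ξ∈h d e d*e≡n (suc q) _ _ | yes refl
        with refl ← *-cancelˡ-≡ e 1 n {{ℕ.>-nonZero 1≤n}} (trans d*e≡n (sym (*-identityʳ n))) =
        upward (h n) (mem-⊤ (h n)) (≈-trans (∧-identityˡ _) ξ₁≈⊤)
        where
        ξ₁≈⊤ : ξ 1 (suc q) f ≈ ⊤
        ξ₁≈⊤ rewrite +-comm (q * 1) 1 = ∨-complementˡ (f (suc (q * 1)))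

    post : IsPostSubalgebra (InM h)
    post = record
      { sub       = proj₁
      ; cong-∧    = λ _ _ _ _ f≈f′ g≈g′ j 1≤j j≤n → ∧-cong (f≈f′ j 1≤j j≤n) (g≈g′ j 1≤j j≤n)
      ; cong-∨    = λ _ _ _ _ f≈f′ g≈g′ j 1≤j j≤n → ∨-cong (f≈f′ j 1≤j j≤n) (g≈g′ j 1≤j j≤n)
      ; cong-¬    = λ _ _ → ¬ₙ-cong
      ; cong-σ    = λ i 1≤i i≤n _ _ f≈g _ _ _ → f≈g i 1≤i i≤n
      ; closed-∧  = λ f∈M g∈M → InBn⇒InM λ i j 1≤i i≤j j≤n →
          ∧-mono-≤B (proj₁ f∈M i j 1≤i i≤j j≤n) (proj₁ g∈M i j 1≤i i≤j j≤n)
      ; closed-∨  = λ f∈M g∈M → InBn⇒InM λ i j 1≤i i≤j j≤n →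
          ∨-mono-≤B (proj₁ f∈M i j 1≤i i≤j j≤n) (proj₁ g∈M i j 1≤i i≤j j≤n)
      ; closed-¬  = IsNValuedWajsbergSubalgebra.closed-¬ wajsberg
      ; closed-0  = InBn⇒InM λ _ _ _ _ _ → ∧-idem ⊥
      ; closed-1  = InBn⇒InM λ _ _ _ _ _ → ∧-idem ⊤
      ; closed-σ  = λ i _ _ {f} _ → InBn⇒InM λ _ _ _ _ _ → ∧-idem (f i)
      ; closed-c  = λ k _ → InBn⇒InM (c-InBn k)
      ; ∧-comm    = λ _ _ _ _ _ → ∧-comm _ _
      ; ∨-comm    = λ _ _ _ _ _ → ∨-comm _ _
      ; ∧-assoc   = λ _ _ _ _ _ _ → ∧-assoc _ _ _
      ; ∨-assoc   = λ _ _ _ _ _ _ → ∨-assoc _ _ _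
      ; ∧-absorb  = λ _ _ _ _ _ → ∧-absorbs-∨ _ _
      ; ∨-absorb  = λ _ _ _ _ _ → ∨-absorbs-∧ _ _
      ; distrib   = λ _ _ _ _ _ _ → ∧-distribˡ-∨ _ _ _
      ; ∨-0       = λ _ _ _ _ → ∨-identityʳ _
      ; ∧-1       = λ _ _ _ _ → ∧-identityʳ _
      ; ¬-invol   = λ {x} _ j _ j≤n →
          ≈-trans (¬-involutive _) (reflexive (cong x (m∸[m∸n]≡n (≤-trans j≤n (m≤m+n n 1)))))
      ; deMorgan  = λ _ _ _ _ _ → deMorgan₁ _ _
      ; σ-∧       = λ _ _ _ _ _ _ _ _ → ≈-refl
      ; σ-∨       = λ _ _ _ _ _ _ _ _ → ≈-refl
      ; σ-0       = λ _ _ _ _ _ _ → ≈-refl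
      ; σ-1       = λ _ _ _ _ _ _ → ≈-refl
      ; σ-compl∨  = λ i _ _ {x} _ _ _ _ → ∨-complementʳ (x i)
      ; σ-compl∧  = λ i _ _ {x} _ _ _ _ → ∧-complementʳ (x i)
      ; σ-σ       = λ _ _ _ _ _ _ _ _ _ _ → ≈-refl
      ; σ-¬       = λ _ _ _ _ _ _ _ → ≈-refl
      ; σ-mono    = λ i j 1≤i i≤j j≤n x∈M _ _ _ → proj₁ x∈M i j 1≤i i≤j j≤n
      ; determine = λ _ _ σx≈σy j 1≤j j≤n → σx≈σy j 1≤j j≤n j 1≤j j≤n
      ; σ-c-top   = λ i k _ _ _ n+1≤i+k _ _ _ →
          c≈⊤ k (m≤n+o⇒m∸n≤o (n + 1) k (subst (n + 1 ≤_) (+-comm i k) n+1≤i+k))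
      ; σ-c-bot   = λ i k _ _ _ i+k≤n _ _ _ →
          c≈⊥ k (m+n≤o⇒m≤o∸n (suc i) (subst (suc (i + k) ≤_) (+-comm 1 n) (s≤s i+k≤n)))
      }

corollary1 : ∀ {c ℓ ℓ'} (𝔹 : BooleanAlgebra c ℓ) (n : ℕ) → 1 ≤ n →
             (h : ℕ → Filter 𝔹 ℓ') →
             Bn.IsNValuedWajsbergSubalgebra 𝔹 n (Bn.InM 𝔹 n h)
             × ((∀ d → d ∣ n → ¬ (d ≡ n) → ∀ x → Filter.mem (h d) x) →
                Bn.IsPostSubalgebra 𝔹 n (Bn.InM 𝔹 n h))
corollary1 𝔹 n 1≤n h = wajsberg , Post.post
  where open Closure 𝔹 n 1≤n h
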